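{- Let $E(x)=2^{2^{2^x}}$. For any strictly increasing sequence of natural numbers $3\leq x_0<x_1<x_2<\dots$ (of length at least $E(x_0)+9$), we have $\omega^3[x_0][x_1]\dots[x_{E(x_0)+8}]>0$.
   Context: Ordinals below $\varepsilon_0$ are represented as sums $\omega^{\alpha_0}+\dots+\omega^{\alpha_n}$ with $\alpha_0\geq\dots\geq\alpha_n$, and $0$ is the empty sum. Fundamental sequences are defined as follows: $0[x]=0$ and $(\alpha+1)[x]=\alpha$. For $\alpha=\omega^{\alpha_0}+\dots+\omega^{\alpha_n}$: if $\alpha_n=\beta+1$, then $\alpha[x]=\omega^{\alpha_0}+\dots+\omega^{\alpha_{n-1}}+\omega^{\beta}\cdot x$; if $\alpha_n$ is a limit, then $\alpha[x]=\omega^{\alpha_0}+\dots+\omega^{\alpha_{n-1}}+\omega^{\alpha_n[x]}$. Iterated application is written $\alpha[x_0][x_1]\dots$. -}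

module Defs where

open import Data.Nat using (ℕ; zero; suc; _+_; _^_)
open import Data.List using (List; []; _∷_; replicate)
open import Data.Maybe using (Maybe; just; nothing)

-- Ordinal terms below ε₀ in Cantor normal form:
-- `sum (α₀ ∷ … ∷ αₙ ∷ [])` denotes ω^α₀ + … + ω^αₙ, and `sum []` is 0.
-- (The normal-form invariant α₀ ≥ … ≥ αₙ is preserved by the fundamental
-- sequences below on the terms considered; it is not needed as a predicate.)
data Ord : Set where
  sum : List Ord → Ord

zeroO : Ord
zeroO = sum []

-- If the list of exponents ends with 0 (i.e. the ordinal is β + 1),
-- return the exponents of β; otherwise nothing.
predExps : List Ord → Maybe (List Ord)
predExps [] = nothing
predExps (sum [] ∷ []) = just []
predExps (sum (_ ∷ _) ∷ []) = nothing
predExps (a ∷ b ∷ l) with predExps (b ∷ l)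
... | just l' = just (a ∷ l')
... | nothing = nothing

-- helper: `choose (predExps l) (l[x]) x` gives the exponents of (ω^(sum l))[x]
-- for nonempty l: successor case ω^β·x, limit case ω^(sum l [x]).
choose : Maybe (List Ord) → List Ord → ℕ → List Ord
choose (just β) r x = replicate x (sum β)
choose nothing r x = sum r ∷ []

mutual
  fsList : List Ord → ℕ → List Ord
  fsList [] x = []
  fsList (a ∷ []) x = fsω a x
  fsList (a ∷ b ∷ l) x = a ∷ fsList (b ∷ l) x

  -- exponents of (ω^α)[x]:
  --   α = 0      : ω^0 = 1 = 0+1, so 1[x] = 0
  --   α = β + 1  : ω^β · x
  --   α limit    : ω^(α[x])
  fsω : Ord → ℕ → List Ord
  fsω (sum []) x = []
  fsω (sum (a ∷ l)) x = choose (predExps (a ∷ l)) (fsList (a ∷ l) x) x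

_[_] : Ord → ℕ → Ord
sum l [ x ] = sum (fsList l x)

iterFS : Ord → (ℕ → ℕ) → ℕ → Ord
iterFS α f zero = α
iterFS α f (suc k) = iterFS α f k [ f k ]

threeO : Ord
threeO = sum (zeroO ∷ zeroO ∷ zeroO ∷ [])

ω^3 : Ord
ω^3 = sum (threeO ∷ [])

Pos : Ord → Set
Pos (sum []) = Data.Empty.⊥ where import Data.Empty
Pos (sum (_ ∷ _)) = Data.Unit.⊤ where import Data.Unit

E : ℕ → ℕ
E x = 2 ^ (2 ^ (2 ^ x))

-- Write α < ω³ as ω²·a + ω·b + c and let xₜ be the argument of the (t+1)-st
-- fundamental-sequence step. The potential Φₜ(α) = tower a ((t + c + 4)·2ᵇ),
-- an a-fold iterated exponential, never decreases along α ↦ α[xₜ] as long as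
-- xₜ ≥ t + 3, which strict monotonicity and x₀ ≥ 3 guarantee. After the first
-- step α = ω²·x₀, whose potential is a tower of height x₀ over 5; a zero
-- ordinal after t steps has potential only t + 4. So the sequence cannot reach
-- 0 within E(x₀) + 9 steps, since E(x₀) + 13 is far below that tower.
module Submission where

open import Defs
open import Data.Nat using (ℕ; zero; suc; _+_; _*_; _^_; _≤_; _<_; s≤s)
open import Data.Nat.Properties
open import Data.Nat.Tactic.RingSolver using (solve-∀)
open import Data.List using (List; []; _∷_; _++_; replicate)
open import Data.List.Properties using (++-assoc; ++-identityʳ)
open import Data.Product using (_,_)
open import Data.Unit using (tt)
open import Relation.Binary.PropositionalEquality
  using (_≡_; refl; sym; trans; cong; subst; module ≡-Reasoning)

oneO twoO : Ord
oneO = sum (zeroO ∷ [])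
twoO = sum (zeroO ∷ zeroO ∷ [])

fsList-++-replicate : ∀ p q n x →
  fsList (p ++ replicate (suc n) q) x ≡ p ++ replicate n q ++ fsω q x
fsList-++-replicate []           q zero    x = refl
fsList-++-replicate []           q (suc n) x = cong (q ∷_) (fsList-++-replicate [] q n x)
fsList-++-replicate (y ∷ [])     q n       x = cong (y ∷_) (fsList-++-replicate [] q n x)
fsList-++-replicate (y ∷ z ∷ p)  q n       x = cong (y ∷_) (fsList-++-replicate (z ∷ p) q n x)

data Below-ω³ : Set where
  ω²·_+ω·_+_ : ℕ → ℕ → ℕ → Below-ω³

⟦_⟧ : Below-ω³ → Ord
⟦ ω²· a +ω· b + c ⟧ = sum (replicate a twoO ++ replicate b oneO ++ replicate c zeroO)

_⟨_⟩ : Below-ω³ → ℕ → Below-ω³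
(ω²· a     +ω· b     + suc c) ⟨ x ⟩ = ω²· a +ω· b + c
(ω²· a     +ω· suc b + zero)  ⟨ x ⟩ = ω²· a +ω· b + x
(ω²· suc a +ω· zero  + zero)  ⟨ x ⟩ = ω²· a +ω· x + zero
(ω²· zero  +ω· zero  + zero)  ⟨ x ⟩ = ω²· zero +ω· zero + zero

⟦⟧-[] : ∀ α x → ⟦ α ⟧ [ x ] ≡ ⟦ α ⟨ x ⟩ ⟧
⟦⟧-[] (ω²· a +ω· b + suc c) x = cong sum (begin
  fsList (A ++ B ++ replicate (suc c) zeroO) x
    ≡⟨ cong (λ l → fsList l x) (sym (++-assoc A B _)) ⟩
  fsList ((A ++ B) ++ replicate (suc c) zeroO) x
    ≡⟨ fsList-++-replicate (A ++ B) zeroO c x ⟩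
  (A ++ B) ++ replicate c zeroO ++ []
    ≡⟨ trans (++-assoc A B _) (cong (λ l → A ++ B ++ l) (++-identityʳ _)) ⟩
  A ++ B ++ replicate c zeroO ∎)
  where
  open ≡-Reasoning
  A = replicate a twoO
  B = replicate b oneO
⟦⟧-[] (ω²· a +ω· suc b + zero) x = cong sum
  (trans (cong (λ l → fsList (A ++ l) x) (++-identityʳ _))
         (fsList-++-replicate A oneO b x))
  where A = replicate a twoO
⟦⟧-[] (ω²· suc a +ω· zero + zero) x = cong sum
  (trans (cong (λ l → fsList l x) (++-identityʳ (replicate (suc a) twoO)))
         (trans (fsList-++-replicate [] twoO a x)
                (cong (replicate a twoO ++_) (sym (++-identityʳ (replicate x oneO))))))
⟦⟧-[] (ω²· zero +ω· zero + zero) x = refl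

fsTrace : (ℕ → ℕ) → ℕ → Below-ω³
fsTrace x zero    = ω²· x 0 +ω· 0 + 0
fsTrace x (suc k) = fsTrace x k ⟨ x (suc k) ⟩

iterFS-ω^3 : ∀ x k → iterFS ω^3 x (suc k) ≡ ⟦ fsTrace x k ⟧
iterFS-ω^3 x zero    = cong sum (sym (++-identityʳ _))
iterFS-ω^3 x (suc k) =
  trans (cong (_[ x (suc k) ]) (iterFS-ω^3 x k)) (⟦⟧-[] (fsTrace x k) (x (suc k)))

tower : ℕ → ℕ → ℕ
tower zero    u = u
tower (suc a) u = 2 ^ tower a u

tower-mono : ∀ a {u v} → u ≤ v → tower a u ≤ tower a v
tower-mono zero    u≤v = u≤v
tower-mono (suc a) u≤v = ^-monoʳ-≤ 2 (tower-mono a u≤v)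

tower-2^ : ∀ a u → tower a (2 ^ u) ≡ tower (suc a) u
tower-2^ zero    u = refl
tower-2^ (suc a) u = cong (2 ^_) (tower-2^ a u)

n<2^n : ∀ n → n < 2 ^ n
n<2^n zero    = s≤s ≤-refl
n<2^n (suc n) = begin-strict
  suc n          ≤⟨ n<2^n n ⟩
  2 ^ n          <⟨ m<m+n (2 ^ n) (m^n>0 2 n) ⟩
  2 ^ n + 2 ^ n  ≡⟨ cong (2 ^ n +_) (sym (+-identityʳ (2 ^ n))) ⟩
  2 ^ suc n      ∎
  where open ≤-Reasoning

m+u≤tower : ∀ m u → m + u ≤ tower m u
m+u≤tower zero    u = ≤-refl
m+u≤tower (suc m) u = ≤-trans (s≤s (m+u≤tower m u)) (n<2^n (tower m u))

Φ : ℕ → Below-ω³ → ℕ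
Φ t (ω²· a +ω· b + c) = tower a ((t + c + 4) * 2 ^ b)

Φ-step : ∀ t α x → t + 3 ≤ x → Φ t α ≤ Φ (suc t) (α ⟨ x ⟩)
Φ-step t (ω²· a +ω· b + suc c) x _ =
  ≤-reflexive (cong (λ s → tower a ((s + 4) * 2 ^ b)) (+-suc t c))
Φ-step t (ω²· a +ω· suc b + zero) x t+3≤x = tower-mono a (begin
  (t + 0 + 4) * (2 * 2 ^ b)     ≡⟨ double t (2 ^ b) ⟩
  (t + 4 + (t + 3 + 1)) * 2 ^ b ≤⟨ *-monoˡ-≤ (2 ^ b) (+-monoʳ-≤ (t + 4) (+-monoˡ-≤ 1 t+3≤x)) ⟩
  (t + 4 + (x + 1)) * 2 ^ b     ≡⟨ cong (_* 2 ^ b) (shift t x) ⟩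
  (suc t + x + 4) * 2 ^ b       ∎)
  where
  open ≤-Reasoning
  double : ∀ t p → (t + 0 + 4) * (2 * p) ≡ (t + 4 + (t + 3 + 1)) * p
  double = solve-∀
  shift : ∀ t x → t + 4 + (x + 1) ≡ suc t + x + 4
  shift = solve-∀
Φ-step t (ω²· suc a +ω· zero + zero) x t+3≤x = begin
  tower (suc a) ((t + 0 + 4) * 1)   ≡⟨ sym (tower-2^ a _) ⟩
  tower a (2 ^ ((t + 0 + 4) * 1))   ≡⟨ cong (λ e → tower a (2 ^ e)) (normalise t) ⟩
  tower a (2 * 2 ^ (t + 3))         ≤⟨ tower-mono a (*-monoʳ-≤ 2 (^-monoʳ-≤ 2 t+3≤x)) ⟩
  tower a (2 * 2 ^ x)               ≤⟨ tower-mono a (*-monoˡ-≤ (2 ^ x) (m≤n+m 2 (suc t + 0 + 2))) ⟩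
  tower a ((suc t + 0 + 2 + 2) * 2 ^ x) ≡⟨ cong (λ s → tower a (s * 2 ^ x)) (+-assoc (suc t + 0) 2 2) ⟩
  tower a ((suc t + 0 + 4) * 2 ^ x) ∎
  where
  open ≤-Reasoning
  normalise : ∀ t → (t + 0 + 4) * 1 ≡ suc (t + 3)
  normalise = solve-∀
Φ-step t (ω²· zero +ω· zero + zero) x _ = *-monoˡ-≤ 1 (+-monoˡ-≤ 4 (+-monoˡ-≤ 0 (n≤1+n t)))

Φ-fsTrace : ∀ x k → (∀ i → i ≤ k → i + 3 ≤ x i) → tower (x 0) 5 ≤ Φ (suc k) (fsTrace x k)
Φ-fsTrace x zero    _   = ≤-refl
Φ-fsTrace x (suc k) x≥ = ≤-trans (Φ-fsTrace x k (λ i i≤k → x≥ i (m≤n⇒m≤1+n i≤k)))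
                                  (Φ-step (suc k) (fsTrace x k) (x (suc k)) (x≥ (suc k) ≤-refl))

t+4<Φ⇒Pos : ∀ t α → t + 4 < Φ t α → Pos ⟦ α ⟧
t+4<Φ⇒Pos t (ω²· suc a +ω· b     + c)     _ = tt
t+4<Φ⇒Pos t (ω²· zero  +ω· suc b + c)     _ = tt
t+4<Φ⇒Pos t (ω²· zero  +ω· zero  + suc c) _ = tt
t+4<Φ⇒Pos t (ω²· zero  +ω· zero  + zero)  t+4<Φ =
  <-irrefl (sym (trans (*-identityʳ _) (cong (_+ 4) (+-identityʳ t)))) t+4<Φ

strictMono⇒i+x₀≤xᵢ : ∀ (x : ℕ → ℕ) n → (∀ i → i < n → x i < x (suc i)) →
                     ∀ i → i ≤ n → i + x 0 ≤ x i
strictMono⇒i+x₀≤xᵢ x n _   zero    _     = ≤-refl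
strictMono⇒i+x₀≤xᵢ x n inc (suc i) 1+i≤n =
  ≤-trans (s≤s (strictMono⇒i+x₀≤xᵢ x n inc i (<⇒≤ 1+i≤n))) (inc i 1+i≤n)

E-mono : ∀ {m n} → m ≤ n → E m ≤ E n
E-mono m≤n = ^-monoʳ-≤ 2 (^-monoʳ-≤ 2 (^-monoʳ-≤ 2 m≤n))

E+13<E[1+n] : ∀ n → 1 ≤ n → E n + 13 < E (suc n)
E+13<E[1+n] n 1≤n = begin-strict
  2 ^ k + 13     <⟨ +-monoʳ-< (2 ^ k) 13<2^k ⟩
  2 ^ k + 2 ^ k  ≡⟨ cong (2 ^ k +_) (sym (+-identityʳ (2 ^ k))) ⟩
  2 ^ suc k      ≤⟨ ^-monoʳ-≤ 2 (^-monoʳ-< 2 (n<1+n 1) (^-monoʳ-< 2 (n<1+n 1) (n<1+n n))) ⟩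
  E (suc n)      ∎
  where
  open ≤-Reasoning
  k = 2 ^ (2 ^ n)
  13<2^k : 13 < 2 ^ k
  13<2^k = ≤-trans (m≤m+n 14 2) (^-monoʳ-≤ 2 {4} (^-monoʳ-≤ 2 {2} (^-monoʳ-≤ 2 1≤n)))

E+13<tower : ∀ n → 3 ≤ n → E n + 13 < tower n 5
E+13<tower n 3≤n with m≤n⇒∃[o]m+o≡n 3≤n
... | m , refl = ≤-trans (E+13<E[1+n] (3 + m) (m≤m+n 1 (2 + m))) (E-mono 4+m≤tower)
  where
  4+m≤tower : 4 + m ≤ tower m 5
  4+m≤tower = ≤-trans (≤-reflexive (+-comm 4 m)) (≤-trans (+-monoʳ-≤ m (n≤1+n 4)) (m+u≤tower m 5))

lemma4 : (x : ℕ → ℕ) → 3 ≤ x 0 →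
    (∀ i → i < E (x 0) + 8 → x i < x (suc i)) →
    Pos (iterFS ω^3 x (E (x 0) + 9))
lemma4 x 3≤x₀ inc =
  subst Pos (sym (trans (cong (iterFS ω^3 x) (+-suc (E (x 0)) 8)) (iterFS-ω^3 x M)))
    (t+4<Φ⇒Pos (suc M) (fsTrace x M) (begin-strict
      suc M + 4           ≡⟨ cong (_+ 4) (+-suc (E (x 0)) 8) ⟨
      E (x 0) + 9 + 4      ≡⟨ +-assoc (E (x 0)) 9 4 ⟩
      E (x 0) + 13         <⟨ E+13<tower (x 0) 3≤x₀ ⟩
      tower (x 0) 5        ≤⟨ Φ-fsTrace x M xᵢ≥i+3 ⟩
      Φ (suc M) (fsTrace x M) ∎))
  where
  open ≤-Reasoning
  M = E (x 0) + 8
  xᵢ≥i+3 : ∀ i → i ≤ M → i + 3 ≤ x i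
  xᵢ≥i+3 i i≤M = ≤-trans (+-monoʳ-≤ i 3≤x₀) (strictMono⇒i+x₀≤xᵢ x M inc i i≤M)
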